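{- For any consistent triple set $R$, $$\mathfrak L^*(R;R)=\mathfrak L^*(\mathrm{cl}(R);R)=\mathfrak L^*(\mathrm{cl}(R);\mathrm{cl}(R)).$$
   Context: A rooted tree $T$ has a distinguished inner vertex (root); leaves are degree-1 vertices; inner vertices other than the root have degree at least 3. A triple $ab|c$ is the rooted binary tree on leaves $a,b,c$ where the path from $a$ to $b$ avoids the path from $c$ to the root; $ab|c=ba|c$. A rooted tree displays $ab|c$ if $a,b,c$ are leaves and the path from $a$ to $b$ does not intersect the path from $c$ to the root; $\mathcal R(T)$ is the set of displayed triples. A triple set is consistent if some rooted tree displays all its triples. $L_R$ is the set of leaves appearing in $R$. $\mathrm{cl}(R)=\bigcap\mathcal R(T)$ over all rooted trees $T$ with leaf set $L_R$ displaying $R$ (note $\mathrm{cl}(R)$ is consistent with $L_{\mathrm{cl}(R)}=L_R$). For a triple set $S$ and $\mathcal L\subseteq L_S$, the Ahograph $[S,\mathcal L]$ has vertex set $\mathcal L$, distinct $x,y\in\mathcal L$ adjacent iff some $xy|z\in S$ has $z\in\mathcal L$; connected components are identified with vertex sets. For $a,b,c\in L_S$, $\mathfrak L(ab|c;S)$ is the set of unordered pairs $\{A,B\}$, $A,B\subseteq L_S$, such that $[S,A\cup B]$ has exactly two connected components $A$ and $B$, one containing $a,b$ and the other $c$. For consistent $S$ and $ab|c\in\mathrm{cl}(S)$ this set has a unique element maximizing $|A\cup B|$, denoted $\mathfrak L^*(ab|c;S)$; for $S'\subseteq\mathrm{cl}(S)$, $\mathfrak L^*(S';S)=\{\mathfrak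 L^*(r;S):r\in S'\}$. -}

module Defs where

open import Data.Nat using (ℕ; _≤_; _≟_)
open import Data.List using (List; []; _∷_; [_]; _++_; length; deduplicate)
open import Data.List.Membership.Propositional using (_∈_; _∉_)
open import Data.List.Relation.Unary.All using (All)
open import Data.List.Relation.Unary.Any using (Any)
open import Data.List.Relation.Unary.Unique.Propositional using (Unique)
open import Data.Product using (Σ; ∃; ∃-syntax; _×_; _,_)
open import Data.Sum using (_⊎_)
open import Data.Empty using (⊥)
open import Relation.Nullary using (¬_)
open import Relation.Binary.PropositionalEquality using (_≡_; _≢_)
open import Relation.Binary.Construct.Closure.ReflexiveTransitive using (Star)
open import Function.Bundles using (_⇔_)

data Tree : Set where
  leaf : ℕ → Tree
  node : List Tree → Tree

mutual
  leaves : Tree → List ℕ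
  leaves (leaf x)  = [ x ]
  leaves (node cs) = leavesL cs

  leavesL : List Tree → List ℕ
  leavesL []       = []
  leavesL (t ∷ ts) = leaves t ++ leavesL ts

-- non-root vertices: inner ones have at least two children (degree ≥ 3)
data NonRootOK : Tree → Set where
  leafOK : ∀ {x} → NonRootOK (leaf x)
  nodeOK : ∀ {cs} → 2 ≤ length cs → All NonRootOK cs → NonRootOK (node cs)

-- a rooted tree: the root is an inner vertex (not a leaf, so it does
-- not have exactly one child), all other inner vertices have ≥ 2
-- children, and leaf labels are pairwise distinct.
IsRootedTree : Tree → Set
IsRootedTree T =
  Σ (List Tree) λ cs → (T ≡ node cs) × (length cs ≢ 1) × All NonRootOK cs
    × Unique (leaves T)

-- vertices of T, identified with the subtrees hanging below them
data _⊑_ : Tree → Tree → Set where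
  here  : ∀ {T} → T ⊑ T
  child : ∀ {S T cs} → T ∈ cs → S ⊑ T → S ⊑ node cs

-- Triples.  (a , b , c) stands for ab|c.

Triple : Set
Triple = ℕ × ℕ × ℕ

tswap : Triple → Triple
tswap (a , b , c) = (b , a , c)

-- triple sets (possibly infinite predicates, e.g. cl(R))
TripleSet : Set₁
TripleSet = Triple → Set

-- a finite triple set given by a list; ab|c = ba|c
_∈ᵀ_ : Triple → List Triple → Set
t ∈ᵀ R = Any (λ s → (t ≡ s) ⊎ (tswap t ≡ s)) R

toSet : List Triple → TripleSet
toSet R t = t ∈ᵀ R

inTriple : ℕ → Triple → Set
inTriple x (a , b , c) = (x ≡ a) ⊎ (x ≡ b) ⊎ (x ≡ c)

LeafSet : TripleSet → ℕ → Set
LeafSet S x = ∃[ t ] (S t × inTriple x t)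

-- T displays ab|c: a,b,c distinct leaves of T, and some vertex v of T
-- lies above a and b but not above c (equivalently, the a–b path
-- avoids the path from c to the root).
Displays : Tree → Triple → Set
Displays T (a , b , c) =
  (a ≢ b) × (a ≢ c) × (b ≢ c)
  × a ∈ leaves T × b ∈ leaves T × c ∈ leaves T
  × ∃[ v ] (v ⊑ T × a ∈ leaves v × b ∈ leaves v × c ∉ leaves v)

Consistent : List Triple → Set
Consistent R = ∃[ T ] (IsRootedTree T × (∀ t → t ∈ᵀ R → Displays T t))

cl : List Triple → TripleSet
cl R t = ∀ T → IsRootedTree T
           → (∀ x → (x ∈ leaves T) ⇔ LeafSet (toSet R) x)
           → (∀ s → s ∈ᵀ R → Displays T s)
           → Displays T t

-- Ahographs [S, V], vertex sets given by lists (compared as sets)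

Edge : TripleSet → List ℕ → ℕ → ℕ → Set
Edge S V x y = (x ≢ y) × x ∈ V × y ∈ V
               × ∃[ z ] (z ∈ V × (S (x , y , z) ⊎ S (y , x , z)))

Path : TripleSet → List ℕ → ℕ → ℕ → Set
Path S V = Star (Edge S V)

_⊆ˡ_ : List ℕ → List ℕ → Set
A ⊆ˡ B = ∀ {x} → x ∈ A → x ∈ B

_≐_ : List ℕ → List ℕ → Set
A ≐ B = (A ⊆ˡ B) × (B ⊆ˡ A)

IsComponent : TripleSet → List ℕ → List ℕ → Set
IsComponent S V C =
  (∃[ x ] (x ∈ C)) × (C ⊆ˡ V)
  × (∀ x y → x ∈ C → y ∈ C → Path S V x y)
  × (∀ x y → x ∈ C → y ∈ V → Path S V x y → y ∈ C)

ExactlyTwoComponents : TripleSet → List ℕ → List ℕ → Set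
ExactlyTwoComponents S A B =
  IsComponent S (A ++ B) A × IsComponent S (A ++ B) B × ¬ (A ≐ B)
  × (∀ C → IsComponent S (A ++ B) C → (C ≐ A) ⊎ (C ≐ B))

-- {A, B} ∈ 𝔏(ab|c; S)   (symmetric in A, B: an unordered pair)
InFrakL : Triple → TripleSet → List ℕ → List ℕ → Set
InFrakL (a , b , c) S A B =
  (∀ {x} → x ∈ A → LeafSet S x) × (∀ {x} → x ∈ B → LeafSet S x)
  × ExactlyTwoComponents S A B
  × ((a ∈ A × b ∈ A × c ∈ B) ⊎ (a ∈ B × b ∈ B × c ∈ A))

cardUnion : List ℕ → List ℕ → ℕ
cardUnion A B = length (deduplicate _≟_ (A ++ B))

IsFrakLStar : Triple → TripleSet → List ℕ → List ℕ → Set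
IsFrakLStar r S A B =
  InFrakL r S A B × (∀ A' B' → InFrakL r S A' B' → cardUnion A' B' ≤ cardUnion A B)

InFrakLStarSet : TripleSet → TripleSet → List ℕ → List ℕ → Set
InFrakLStarSet S' S A B = ∃[ r ] (S' r × IsFrakLStar r S A B)

module Submission where

open import Defs
open import Data.List using (List)
open import Data.Nat using (ℕ)
open import Data.Product using (_×_)
open import Function.Bundles using (_⇔_)

open import Data.Nat as ℕ using (zero; suc; _≤_; _<_; z≤n; s≤s)
import Data.Nat.Properties as ℕₚ
open import Data.List using ([]; _∷_; _++_; length; filter; deduplicate)
import Data.List.Properties as Listₚ
open import Data.List.Membership.Propositional using (_∈_; _∉_; find; lose)
open import Data.List.Membership.Propositional.Properties
  using (∈-++⁺ˡ; ∈-++⁺ʳ; ∈-++⁻; ∈-filter⁺; ∈-filter⁻; ∈-∃++; ∈-deduplicate⁺; ∈-deduplicate⁻)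
open import Data.List.Membership.DecPropositional ℕ._≟_ using (_∈?_)
open import Data.List.Relation.Unary.Any as Any using (here; there; any?)
open import Data.List.Relation.Unary.All as All using (All; []; _∷_; all?)
import Data.List.Relation.Unary.All.Properties as Allₚ
open import Data.List.Relation.Unary.AllPairs using ([]; _∷_)
open import Data.List.Relation.Unary.Unique.Propositional using (Unique)
import Data.List.Relation.Unary.Unique.Propositional.Properties as Uniqueₚ
import Data.List.Relation.Unary.Unique.DecPropositional.Properties ℕ._≟_ as UniqueDecₚ
open import Data.Maybe using (Maybe; just; nothing)
open import Data.Product using (Σ; ∃-syntax; _,_; proj₁; proj₂)
open import Data.Sum using (_⊎_; inj₁; inj₂; [_,_]′)
import Data.Sum as Sum
open import Data.Empty using (⊥; ⊥-elim)
open import Relation.Nullary using (¬_; Dec; yes; no)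
open import Relation.Nullary.Decidable using (_×-dec_; _⊎-dec_; ¬?)
open import Relation.Binary.PropositionalEquality
  using (_≡_; _≢_; refl; sym; trans; cong; cong₂; subst; module ≡-Reasoning)
open import Relation.Binary.Construct.Closure.ReflexiveTransitive using (Star; ε; _◅_; _◅◅_)
import Relation.Binary.Construct.Closure.ReflexiveTransitive as Star
open import Function using (_∘′_)
open import Function.Bundles using (mk⇔; Equivalence)

-- Fix a tree T₀ displaying R, and let Tₛ be its restriction to L_R; Tₛ is
-- one of the trees defining cl(R), so it displays every triple of cl(R).
-- The argument rests on three facts.
--  * Aho's separation lemma: if T displays S, then for any set W of at least
--    two leaves the Ahograph [S, W] is disconnected (its edges stay below
--    single children of the lowest common ancestor of W).
--  * Transfer: if A, B are the two components of [R, A ∪ B] then also of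
--    [cl(R), A ∪ B]; so 𝔏(r; R) ⊆ 𝔏(r; cl(R)).
--  * Domination: for ab|c ∈ cl(R) and V ⊆ L_R whose vertices are joined to
--    a or c in [cl(R), V], some {A, B} ∈ 𝔏(ab|c; R) has V ⊆ A ∪ B.  This runs
--    Aho's algorithm from L_R, repeatedly cutting off what is not joined to
--    a or c; each cut-off part can be hung as a separate subtree of a tree
--    displaying R, so no triple of cl(R) crosses a cut.
-- With cardinality bookkeeping these give 𝔏*(r; R) = 𝔏*(r; cl(R)) for every
-- r ∈ cl(R) (second equality), and 𝔏*(r; R) = 𝔏*(r'; R) for a triple r' ∈ R
-- inside A ∪ B separating A from B (first equality).

unique-++ˡ : ∀ {xs ys : List ℕ} → Unique (xs ++ ys) → Unique xs
unique-++ˡ {[]}     u       = []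
unique-++ˡ {x ∷ xs} (p ∷ u) = Allₚ.++⁻ˡ xs p ∷ unique-++ˡ u

unique-++ʳ : ∀ {xs ys : List ℕ} → Unique (xs ++ ys) → Unique ys
unique-++ʳ {[]}     u       = u
unique-++ʳ {x ∷ xs} (p ∷ u) = unique-++ʳ {xs} u

unique-++-disjoint : ∀ {xs ys : List ℕ} {x} → Unique (xs ++ ys) → x ∈ xs → x ∈ ys → ⊥
unique-++-disjoint {y ∷ xs} (p ∷ u) (here refl) q = All.lookup (Allₚ.++⁻ʳ xs p) q refl
unique-++-disjoint {y ∷ xs} (p ∷ u) (there m)   q = unique-++-disjoint {xs} u m q

counterexample : ∀ {P : ℕ → Set} → (∀ x → Dec (P x)) → ∀ xs → ¬ All P xs → ∃[ y ] (y ∈ xs × ¬ P y)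
counterexample P? xs ¬all = find (Allₚ.¬All⇒Any¬ P? xs ¬all)

leaves-child : ∀ {c cs x} → c ∈ cs → x ∈ leaves c → x ∈ leavesL cs
leaves-child {cs = c ∷ cs} (here refl) m = ∈-++⁺ˡ m
leaves-child {cs = c ∷ cs} (there p)   m = ∈-++⁺ʳ (leaves c) (leaves-child p m)

leaves-⊑ : ∀ {v T x} → v ⊑ T → x ∈ leaves v → x ∈ leaves T
leaves-⊑ here        m = m
leaves-⊑ (child p s) m = leaves-child p (leaves-⊑ s m)

⊑-trans : ∀ {u v w} → u ⊑ v → v ⊑ w → u ⊑ w
⊑-trans s here        = s
⊑-trans s (child p t) = child p (⊑-trans s t)

childContaining : ∀ cs {x} → x ∈ leavesL cs → ∃[ c ] (c ∈ cs × x ∈ leaves c)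
childContaining (c ∷ cs) m with ∈-++⁻ (leaves c) m
... | inj₁ q = c , here refl , q
... | inj₂ q with childContaining cs q
... | d , p , q' = d , there p , q'

childContaining-unique : ∀ {cs c c' x} → Unique (leavesL cs) → c ∈ cs → c' ∈ cs
  → x ∈ leaves c → x ∈ leaves c' → c ≡ c'
childContaining-unique {c ∷ cs} u (here refl) (here refl) m m' = refl
childContaining-unique {c ∷ cs} u (here refl) (there q) m m' =
  ⊥-elim (unique-++-disjoint {leaves c} u m (leaves-child q m'))
childContaining-unique {c ∷ cs} u (there p) (here refl) m m' =
  ⊥-elim (unique-++-disjoint {leaves c} u m' (leaves-child p m))
childContaining-unique {c ∷ cs} u (there p) (there q) m m' =
  childContaining-unique {cs} (unique-++ʳ {leaves c} u) p q m m'

unique-child : ∀ {cs c} → Unique (leavesL cs) → c ∈ cs → Unique (leaves c)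
unique-child {c ∷ cs} u (here refl) = unique-++ˡ u
unique-child {c ∷ cs} u (there p)   = unique-child {cs} (unique-++ʳ {leaves c} u) p

unique-⊑ : ∀ {v T} → Unique (leaves T) → v ⊑ T → Unique (leaves v)
unique-⊑ u here        = u
unique-⊑ u (child p s) = unique-⊑ (unique-child u p) s

nesting : ∀ {T u v x} → Unique (leaves T) → u ⊑ T → v ⊑ T → x ∈ leaves u → x ∈ leaves v
  → u ⊑ v ⊎ v ⊑ u
nesting un here sv mu mv = inj₂ sv
nesting un (child p su) here mu mv = inj₁ (child p su)
nesting {node cs} un (child p su) (child q sv) mu mv
  with childContaining-unique {cs} un p q (leaves-⊑ su mu) (leaves-⊑ sv mv)
... | refl = nesting (unique-child {cs} un p) su sv mu mv

Same : List Tree → ℕ → ℕ → Set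
Same cs x y = ∃[ c ] (c ∈ cs × x ∈ leaves c × y ∈ leaves c)

same? : ∀ cs x y → Dec (Same cs x y)
same? cs x y with any? (λ c → (x ∈? leaves c) ×-dec (y ∈? leaves c)) cs
... | yes p = yes (find p)
... | no ¬p = no λ (c , m , q) → ¬p (lose m q)

same-refl : ∀ {cs x} → x ∈ leavesL cs → Same cs x x
same-refl {cs} m with childContaining cs m
... | c , p , q = c , p , q , q

same-sym : ∀ {cs x y} → Same cs x y → Same cs y x
same-sym (c , m , p , q) = c , m , q , p

same-trans : ∀ {cs x y z} → Unique (leavesL cs) → Same cs x y → Same cs y z → Same cs x z
same-trans {cs} u (c , m , p , q) (c' , m' , p' , q')
  with childContaining-unique {cs} u m m' q p'
... | refl = c , m , p , q'

-- If x and y lie below different children of v and z lies below v, then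
-- the tree does not display xy|z: any vertex above x and y is v or above v.
separated⇒¬displays : ∀ {T cs x y z} → Unique (leaves T) → node cs ⊑ T → ¬ Same cs x y
  → x ∈ leavesL cs → z ∈ leavesL cs → ¬ Displays T (x , y , z)
separated⇒¬displays un sv ¬same mx mz (_ , _ , _ , _ , _ , _ , u , su , xu , yu , zu)
  with nesting un su sv xu mx
... | inj₂ v⊑u         = zu (leaves-⊑ v⊑u mz)
... | inj₁ here        = zu mz
... | inj₁ (child p s) = ¬same (_ , p , leaves-⊑ s xu , leaves-⊑ s yu)

displays-swap : ∀ {T a b c} → Displays T (a , b , c) → Displays T (b , a , c)
displays-swap (ab , ac , bc , ma , mb , mc , v , s , va , vb , vc) =
  (λ e → ab (sym e)) , bc , ac , mb , ma , mc , v , s , vb , va , vc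

displays-child : ∀ {t cs r} → t ∈ cs → Displays t r → Displays (node cs) r
displays-child p (d₁ , d₂ , d₃ , ma , mb , mc , v , s , va , vb , vc) =
  d₁ , d₂ , d₃ , leaves-child p ma , leaves-child p mb , leaves-child p mc , v , child p s , va , vb , vc

SplitVertex : List ℕ → Tree → Set
SplitVertex W T =
  ∃[ cs ] (node cs ⊑ T × W ⊆ˡ leavesL cs × ∃[ x ] ∃[ y ] (x ∈ W × y ∈ W × ¬ Same cs x y))

-- Every set of at least two leaves has a split vertex (its lowest
-- common ancestor), found by descending as long as one child holds W.
module _ (W : List ℕ) {x₀ y₀ : ℕ} (x₀∈W : x₀ ∈ W) (y₀∈W : y₀ ∈ W) (x₀≢y₀ : x₀ ≢ y₀) where

  mutual
    splitVertex : (T : Tree) → Unique (leaves T) → W ⊆ˡ leaves T → SplitVertex W T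
    splitVertex (leaf z) un W⊆ with W⊆ x₀∈W | W⊆ y₀∈W
    ... | here refl | here refl = ⊥-elim (x₀≢y₀ refl)
    splitVertex (node cs) un W⊆ with splitVertexBelow cs un
    ... | inj₁ (c , p , (cs' , s , rest)) = cs' , child p s , rest
    ... | inj₂ noChildHoldsW with childContaining cs (W⊆ x₀∈W)
    ... | c , p , x₀c with counterexample (λ w → w ∈? leaves c) W (noChildHoldsW p)
    ... | y , y∈W , y∉c = cs , here , W⊆ , x₀ , y , x₀∈W , y∈W , λ (c' , p' , x₀c' , yc') →
          y∉c (subst (λ t → y ∈ leaves t) (childContaining-unique {cs} un p' p x₀c' x₀c) yc')

    splitVertexBelow : (cs : List Tree) → Unique (leavesL cs)
      → (∃[ c ] (c ∈ cs × SplitVertex W c)) ⊎ (∀ {c} → c ∈ cs → ¬ All (_∈ leaves c) W)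
    splitVertexBelow [] un = inj₂ λ ()
    splitVertexBelow (c ∷ cs) un with all? (λ w → w ∈? leaves c) W
    ... | yes all = inj₁ (c , here refl , splitVertex c (unique-++ˡ un) (All.lookup all))
    ... | no ¬all with splitVertexBelow cs (unique-++ʳ {leaves c} un)
    ... | inj₁ (d , p , r) = inj₁ (d , there p , r)
    ... | inj₂ none = inj₂ λ { (here refl) → ¬all ; (there p) → none p }

-- Aho's separation lemma: if T displays every triple of S, then at any
-- vertex v above W the edges of the Ahograph [S, W] stay below single
-- children of v.

module AhoSeparation {S : TripleSet} {T : Tree} (un : Unique (leaves T))
                     (displaysS : ∀ t → S t → Displays T t) where

  edge-same : ∀ {cs V u w} → node cs ⊑ T → V ⊆ˡ leavesL cs → Edge S V u w → Same cs u w
  edge-same {cs} {V} {u} {w} sv V⊆ (_ , uV , wV , z , zV , uwz) with same? cs u w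
  ... | yes same = same
  ... | no ¬same = ⊥-elim ([ separated ∘′ displaysS _ , separated ∘′ displays-swap ∘′ displaysS _ ]′ uwz)
    where
      separated : ¬ Displays T (u , w , z)
      separated = separated⇒¬displays un sv ¬same (V⊆ uV) (V⊆ zV)

  path-same : ∀ {cs V u w} → node cs ⊑ T → V ⊆ˡ leavesL cs → Path S V u w → u ∈ V → Same cs u w
  path-same {cs} sv V⊆ ε uV = same-refl {cs} (V⊆ uV)
  path-same {cs} sv V⊆ (e@(_ , _ , wV , _) ◅ p) uV =
    same-trans {cs} (unique-⊑ un sv) (edge-same sv V⊆ e) (path-same sv V⊆ p wV)

  disconnected : ∀ W → W ⊆ˡ leaves T → ∀ {x y} → x ∈ W → y ∈ W → x ≢ y
    → ¬ (∀ {u w} → u ∈ W → w ∈ W → Path S W u w)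
  disconnected W W⊆ x∈W y∈W x≢y connected
    with splitVertex W x∈W y∈W x≢y T un W⊆
  ... | cs , sv , W⊆cs , u , w , uW , wW , ¬same = ¬same (path-same sv W⊆cs (connected uW wW) uW)

record Restriction (Lst : List ℕ) (T t : Tree) : Set where
  field
    nonRoot  : NonRootOK t
    unique   : Unique (leaves t)
    leaves⊆  : ∀ {y} → y ∈ leaves t → y ∈ leaves T × y ∈ Lst
    leaves⊇  : ∀ {y} → y ∈ leaves T → y ∈ Lst → y ∈ leaves t
    displays : ∀ {a b c} → a ∈ Lst → b ∈ Lst → c ∈ Lst → Displays T (a , b , c) → Displays t (a , b , c)

module _ (Lst : List ℕ) where

  suppress : List Tree → Maybe Tree
  suppress []           = nothing
  suppress (t ∷ [])     = just t
  suppress (t ∷ u ∷ ts) = just (node (t ∷ u ∷ ts))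

  consMaybe : Maybe Tree → List Tree → List Tree
  consMaybe nothing  ts = ts
  consMaybe (just t) ts = t ∷ ts

  keepLeaf : (x : ℕ) → Dec (x ∈ Lst) → Maybe Tree
  keepLeaf x (yes _) = just (leaf x)
  keepLeaf x (no _)  = nothing

  mutual
    restrict : Tree → Maybe Tree
    restrict (leaf x)  = keepLeaf x (x ∈? Lst)
    restrict (node cs) = suppress (restrictAll cs)

    restrictAll : List Tree → List Tree
    restrictAll []       = []
    restrictAll (c ∷ cs) = consMaybe (restrict c) (restrictAll cs)

  leavesMaybe : Maybe Tree → List ℕ
  leavesMaybe nothing  = []
  leavesMaybe (just t) = leaves t

  kept : List ℕ → List ℕ
  kept = filter (_∈? Lst)

  mutual
    restrict-leaves : ∀ t → leavesMaybe (restrict t) ≡ kept (leaves t)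
    restrict-leaves (leaf x) with x ∈? Lst
    ... | yes _ = refl
    ... | no _  = refl
    restrict-leaves (node cs) = trans (suppress-leaves (restrictAll cs)) (restrictAll-leaves cs)
      where
        suppress-leaves : ∀ ts → leavesMaybe (suppress ts) ≡ leavesL ts
        suppress-leaves []           = refl
        suppress-leaves (t ∷ [])     = sym (Listₚ.++-identityʳ (leaves t))
        suppress-leaves (t ∷ u ∷ ts) = refl

    restrictAll-leaves : ∀ cs → leavesL (restrictAll cs) ≡ kept (leavesL cs)
    restrictAll-leaves []       = refl
    restrictAll-leaves (c ∷ cs) = begin
      leavesL (consMaybe (restrict c) (restrictAll cs))     ≡⟨ consMaybe-leaves (restrict c) ⟩
      leavesMaybe (restrict c) ++ leavesL (restrictAll cs)  ≡⟨ cong₂ _++_ (restrict-leaves c) (restrictAll-leaves cs) ⟩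
      kept (leaves c) ++ kept (leavesL cs)                  ≡⟨ sym (Listₚ.filter-++ (_∈? Lst) (leaves c) (leavesL cs)) ⟩
      kept (leavesL (c ∷ cs))                               ∎
      where
        open ≡-Reasoning
        consMaybe-leaves : ∀ m → leavesL (consMaybe m (restrictAll cs)) ≡ leavesMaybe m ++ leavesL (restrictAll cs)
        consMaybe-leaves nothing  = refl
        consMaybe-leaves (just t) = refl

  restrict-just-leaves : ∀ t {t'} → restrict t ≡ just t' → leaves t' ≡ kept (leaves t)
  restrict-just-leaves t e = trans (cong leavesMaybe (sym e)) (restrict-leaves t)

  restrict-survives : ∀ t {x} → x ∈ Lst → x ∈ leaves t → ∃[ t' ] (restrict t ≡ just t')
  restrict-survives t {x} xL xt with restrict t in e
  ... | just t' = t' , refl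
  ... | nothing with subst (x ∈_) (trans (sym (restrict-leaves t)) (cong leavesMaybe e)) (∈-filter⁺ (_∈? Lst) xt xL)
  ... | ()

  mutual
    restrict-nonRoot : ∀ t {t'} → restrict t ≡ just t' → NonRootOK t'
    restrict-nonRoot (leaf x) e with x ∈? Lst
    restrict-nonRoot (leaf x) refl | yes _ = leafOK
    restrict-nonRoot (leaf x) ()   | no _
    restrict-nonRoot (node cs) e = suppress-nonRoot (restrictAll cs) (restrictAll-nonRoot cs) e
      where
        suppress-nonRoot : ∀ {t} ts → All NonRootOK ts → suppress ts ≡ just t → NonRootOK t
        suppress-nonRoot (t ∷ [])     (p ∷ _) refl = p
        suppress-nonRoot (t ∷ u ∷ ts) ps      refl = nodeOK (s≤s (s≤s z≤n)) ps

    restrictAll-nonRoot : ∀ cs → All NonRootOK (restrictAll cs)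
    restrictAll-nonRoot []       = []
    restrictAll-nonRoot (c ∷ cs) = consMaybe-nonRoot (restrict c) (restrict-nonRoot c)
      where
        consMaybe-nonRoot : ∀ m → (∀ {t} → m ≡ just t → NonRootOK t) → All NonRootOK (consMaybe m (restrictAll cs))
        consMaybe-nonRoot nothing  f = restrictAll-nonRoot cs
        consMaybe-nonRoot (just t) f = f refl ∷ restrictAll-nonRoot cs

  restrict-⊑ : ∀ {v v' t} → v ⊑ t → restrict v ≡ just v' → ∃[ t' ] (restrict t ≡ just t' × v' ⊑ t')
  restrict-⊑ {v' = v'} here e = v' , e , here
  restrict-⊑ (child {cs = cs} p s) e with restrict-⊑ s e
  ... | c' , e' , s' = suppress-⊑ (restrictAll cs) (restrictAll-∈ p e') s'
    where
      restrictAll-∈ : ∀ {c c' cs} → c ∈ cs → restrict c ≡ just c' → c' ∈ restrictAll cs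
      restrictAll-∈ {cs = d ∷ cs} (here refl) e rewrite e = here refl
      restrictAll-∈ {cs = d ∷ cs} (there p) e with restrict d
      ... | nothing = restrictAll-∈ p e
      ... | just _  = there (restrictAll-∈ p e)
      suppress-⊑ : ∀ {c' v'} ts → c' ∈ ts → v' ⊑ c' → ∃[ t' ] (suppress ts ≡ just t' × v' ⊑ t')
      suppress-⊑ (t ∷ [])     (here refl) s = t , refl , s
      suppress-⊑ (t ∷ u ∷ ts) p           s = node (t ∷ u ∷ ts) , refl , child p s

  restriction : (T : Tree) → Unique (leaves T) → ∀ {x} → x ∈ Lst → x ∈ leaves T
    → ∃[ t ] Restriction Lst T t
  restriction T un xL xT with restrict-survives T xL xT
  ... | t , eq = t , record
    { nonRoot  = restrict-nonRoot T eq
    ; unique   = subst Unique (sym leaves-t) (Uniqueₚ.filter⁺ (_∈? Lst) un)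
    ; leaves⊆  = λ m → ∈-filter⁻ (_∈? Lst) (subst (_ ∈_) leaves-t m)
    ; leaves⊇  = leaves⊇
    ; displays = displays
    }
    where
      leaves-t : leaves t ≡ kept (leaves T)
      leaves-t = restrict-just-leaves T eq

      leaves⊇ : ∀ {y} → y ∈ leaves T → y ∈ Lst → y ∈ leaves t
      leaves⊇ m q = subst (_ ∈_) (sym leaves-t) (∈-filter⁺ (_∈? Lst) m q)

      -- the vertex v separating ab from c survives as a vertex v' of t
      displays : ∀ {a b c} → a ∈ Lst → b ∈ Lst → c ∈ Lst → Displays T (a , b , c) → Displays t (a , b , c)
      displays {a} {b} {c} aL bL cL (a≢b , a≢c , b≢c , aT , bT , cT , v , v⊑T , av , bv , c∉v)
        with restrict-survives v aL av
      ... | v' , ev with restrict-⊑ v⊑T ev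
      ... | t'' , e , v'⊑t'' with trans (sym eq) e
      ... | refl = a≢b , a≢c , b≢c , leaves⊇ aT aL , leaves⊇ bT bL , leaves⊇ cT cL , v' , v'⊑t'' ,
                   kept-v av aL , kept-v bv bL ,
                   λ m → c∉v (proj₁ (∈-filter⁻ (_∈? Lst) (subst (c ∈_) (restrict-just-leaves v ev) m)))
        where
          kept-v : ∀ {y} → y ∈ leaves v → y ∈ Lst → y ∈ leaves v'
          kept-v m q = subst (_ ∈_) (sym (restrict-just-leaves v ev)) (∈-filter⁺ (_∈? Lst) m q)

∈ᵀ-swap : ∀ {R a b c} → (a , b , c) ∈ᵀ R → (b , a , c) ∈ᵀ R
∈ᵀ-swap = Any.map [ inj₂ , inj₁ ]′

_≟ᵀ_ : (s t : Triple) → Dec (s ≡ t)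
(a , b , c) ≟ᵀ (a' , b' , c') with a ℕ.≟ a' | b ℕ.≟ b' | c ℕ.≟ c'
... | yes refl | yes refl | yes refl = yes refl
... | no ne    | _        | _        = no λ { refl → ne refl }
... | yes _    | no ne    | _        = no λ { refl → ne refl }
... | yes _    | yes _    | no ne    = no λ { refl → ne refl }

_∈ᵀ?_ : ∀ t R → Dec (t ∈ᵀ R)
t ∈ᵀ? R = any? (λ s → (t ≟ᵀ s) ⊎-dec (tswap t ≟ᵀ s)) R

leavesOf : List Triple → List ℕ
leavesOf []                = []
leavesOf ((a , b , c) ∷ R) = a ∷ b ∷ c ∷ leavesOf R

leavesOf⇒LeafSet : ∀ R {x} → x ∈ leavesOf R → LeafSet (toSet R) x
leavesOf⇒LeafSet ((a , b , c) ∷ R) (here refl)                 = _ , here (inj₁ refl) , inj₁ refl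
leavesOf⇒LeafSet ((a , b , c) ∷ R) (there (here refl))         = _ , here (inj₁ refl) , inj₂ (inj₁ refl)
leavesOf⇒LeafSet ((a , b , c) ∷ R) (there (there (here refl))) = _ , here (inj₁ refl) , inj₂ (inj₂ refl)
leavesOf⇒LeafSet ((a , b , c) ∷ R) (there (there (there m))) with leavesOf⇒LeafSet R m
... | t , t∈R , x∈t = t , there t∈R , x∈t

LeafSet⇒leavesOf : ∀ R {x} → LeafSet (toSet R) x → x ∈ leavesOf R
LeafSet⇒leavesOf R (t , t∈R , x∈t) = go R t∈R x∈t
  where
    go : ∀ R {t x} → t ∈ᵀ R → inTriple x t → x ∈ leavesOf R
    go (_ ∷ R) (here (inj₁ refl)) (inj₁ refl)        = here refl
    go (_ ∷ R) (here (inj₁ refl)) (inj₂ (inj₁ refl)) = there (here refl)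
    go (_ ∷ R) (here (inj₁ refl)) (inj₂ (inj₂ refl)) = there (there (here refl))
    go (_ ∷ R) (here (inj₂ refl)) (inj₁ refl)        = there (here refl)
    go (_ ∷ R) (here (inj₂ refl)) (inj₂ (inj₁ refl)) = here refl
    go (_ ∷ R) (here (inj₂ refl)) (inj₂ (inj₂ refl)) = there (there (here refl))
    go (_ ∷ R) (there p)          q                  = there (there (there (go R p q)))

displays⇒leaf : ∀ {T x t} → Displays T t → inTriple x t → x ∈ leaves T
displays⇒leaf (_ , _ , _ , ma , mb , mc , _) (inj₁ refl)        = ma
displays⇒leaf (_ , _ , _ , ma , mb , mc , _) (inj₂ (inj₁ refl)) = mb
displays⇒leaf (_ , _ , _ , ma , mb , mc , _) (inj₂ (inj₂ refl)) = mc

≐-refl : ∀ {A} → A ≐ A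
≐-refl = (λ m → m) , (λ m → m)

≐-sym : ∀ {A B} → A ≐ B → B ≐ A
≐-sym (p , q) = q , p

≐-trans : ∀ {A B C} → A ≐ B → B ≐ C → A ≐ C
≐-trans (p , q) (p' , q') = (λ m → p' (p m)) , (λ m → q (q' m))

++-⊆ : ∀ {A B C} → A ⊆ˡ C → B ⊆ˡ C → (A ++ B) ⊆ˡ C
++-⊆ {A} A⊆ B⊆ m = [ A⊆ , B⊆ ]′ (∈-++⁻ A m)

++-≐ : ∀ {A A' B B'} → A ≐ A' → B ≐ B' → (A ++ B) ≐ (A' ++ B')
++-≐ {A} {A'} (p , q) (p' , q') =
  ++-⊆ (λ m → ∈-++⁺ˡ (p m)) (λ m → ∈-++⁺ʳ A' (p' m)) ,
  ++-⊆ (λ m → ∈-++⁺ˡ (q m)) (λ m → ∈-++⁺ʳ A (q' m))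

++-comm-⊆ : ∀ {A B} → (A ++ B) ⊆ˡ (B ++ A)
++-comm-⊆ {A} {B} = ++-⊆ (∈-++⁺ʳ B) ∈-++⁺ˡ

++-comm-≐ : ∀ {A B} → (A ++ B) ≐ (B ++ A)
++-comm-≐ {A} {B} = ++-comm-⊆ {A} , ++-comm-⊆ {B}

length-middle : ∀ (ys₁ : List ℕ) {x ys₂} → length (ys₁ ++ x ∷ ys₂) ≡ suc (length (ys₁ ++ ys₂))
length-middle []        = refl
length-middle (y ∷ ys₁) = cong suc (length-middle ys₁)

drop-middle : ∀ (ys₁ : List ℕ) {x ys₂ y} → y ∈ ys₁ ++ x ∷ ys₂ → y ≢ x → y ∈ ys₁ ++ ys₂
drop-middle ys₁ m ne with ∈-++⁻ ys₁ m
... | inj₁ q         = ∈-++⁺ˡ q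
... | inj₂ (here e)  = ⊥-elim (ne e)
... | inj₂ (there q) = ∈-++⁺ʳ ys₁ q

unique⇒length≤ : ∀ {xs ys : List ℕ} → Unique xs → xs ⊆ˡ ys → length xs ≤ length ys
unique⇒length≤ {[]}     u        ⊆ys = z≤n
unique⇒length≤ {x ∷ xs} (x∉ ∷ u) ⊆ys with ∈-∃++ (⊆ys (here refl))
... | ys₁ , ys₂ , refl rewrite length-middle ys₁ {x} {ys₂} =
  s≤s (unique⇒length≤ u λ m → drop-middle ys₁ (⊆ys (there m)) λ e → All.lookup x∉ m (sym e))

dedup-⊆ : ∀ {A B A' B'} → (A ++ B) ⊆ˡ (A' ++ B')
  → deduplicate ℕ._≟_ (A ++ B) ⊆ˡ deduplicate ℕ._≟_ (A' ++ B')
dedup-⊆ {A} {B} {A'} {B'} ⊆' m = ∈-deduplicate⁺ ℕ._≟_ (⊆' (∈-deduplicate⁻ ℕ._≟_ (A ++ B) m))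

cardUnion-mono : ∀ {A B A' B'} → (A ++ B) ⊆ˡ (A' ++ B') → cardUnion A B ≤ cardUnion A' B'
cardUnion-mono {A} {B} {A'} {B'} ⊆' =
  unique⇒length≤ (UniqueDecₚ.deduplicate-! (A ++ B)) (dedup-⊆ {A} {B} {A'} {B'} ⊆')

cardUnion-strict : ∀ {A B A' B' y} → (A ++ B) ⊆ˡ (A' ++ B') → y ∈ A' ++ B' → y ∉ A ++ B
  → cardUnion A B < cardUnion A' B'
cardUnion-strict {A} {B} {A'} {B'} ⊆' y∈ y∉ =
  unique⇒length≤ (All.tabulate y∉dedup ∷ UniqueDecₚ.deduplicate-! (A ++ B))
    λ { (here refl) → ∈-deduplicate⁺ ℕ._≟_ y∈ ; (there m) → dedup-⊆ {A} {B} {A'} {B'} ⊆' m }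
  where
    y∉dedup : ∀ {x} → x ∈ deduplicate ℕ._≟_ (A ++ B) → _ ≢ x
    y∉dedup m refl = y∉ (∈-deduplicate⁻ ℕ._≟_ (A ++ B) m)

cardUnion-≐ : ∀ {A B A' B'} → (A ++ B) ⊆ˡ (A' ++ B') → cardUnion A' B' ≤ cardUnion A B
  → (A ++ B) ≐ (A' ++ B')
cardUnion-≐ {A} {B} {A'} {B'} ⊆' le = ⊆' , back
  where
    back : ∀ {y} → y ∈ A' ++ B' → y ∈ A ++ B
    back {y} m with y ∈? (A ++ B)
    ... | yes q = q
    ... | no q  = ⊥-elim (ℕₚ.<-irrefl refl (ℕₚ.<-≤-trans (cardUnion-strict {A} {B} {A'} {B'} ⊆' m q) le))

path-monoV : ∀ {S V V' x y} → V ⊆ˡ V' → Path S V x y → Path S V' x y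
path-monoV V⊆ = Star.map λ (ne , xV , yV , z , zV , s) → ne , V⊆ xV , V⊆ yV , z , V⊆ zV , s

path-monoS : ∀ {S S' V x y} → (∀ t → S t → S' t) → Path S V x y → Path S' V x y
path-monoS S⊆ = Star.map λ (ne , xV , yV , z , zV , s) → ne , xV , yV , z , zV , Sum.map (S⊆ _) (S⊆ _) s

edge-sym : ∀ {S V x y} → Edge S V x y → Edge S V y x
edge-sym (ne , xV , yV , z , zV , s) = (λ e → ne (sym e)) , yV , xV , z , zV , Sum.swap s

path-sym : ∀ {S V x y} → Path S V x y → Path S V y x
path-sym {S} {V} = Star.reverse (edge-sym {S} {V})

closed⇒path∈ : ∀ {S V P} → (∀ {u w} → u ∈ P → Edge S V u w → w ∈ P)
  → ∀ {u y} → u ∈ P → Path S V u y → y ∈ P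
closed⇒path∈ closed uP ε       = uP
closed⇒path∈ closed uP (e ◅ p) = closed⇒path∈ closed (closed uP e) p

module _ {S : TripleSet} where

  component-path : ∀ {V C x y} → IsComponent S V C → x ∈ C → y ∈ C → Path S V x y
  component-path (_ , _ , connected , _) = connected _ _

  component-closed : ∀ {V C x y} → IsComponent S V C → x ∈ C → y ∈ V → Path S V x y → y ∈ C
  component-closed (_ , _ , _ , closed) = closed _ _

  component-share : ∀ {V C D x} → IsComponent S V C → IsComponent S V D → x ∈ C → x ∈ D → C ≐ D
  component-share {x = x} (_ , C⊆ , Cconn , Cclosed) (_ , D⊆ , Dconn , Dclosed) xC xD =
    (λ {y} yC → Dclosed x y xD (C⊆ yC) (Cconn x y xC yC)) ,
    (λ {y} yD → Cclosed x y xC (D⊆ yD) (Dconn x y xD yD))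

  component-≐ : ∀ {V V' C C'} → IsComponent S V C → V ≐ V' → C ≐ C' → IsComponent S V' C'
  component-≐ ((x , xC) , C⊆ , conn , closed) (VV' , V'V) (CC' , C'C) =
    (x , CC' xC) , (λ m → VV' (C⊆ (C'C m))) ,
    (λ x y xC yC → path-monoV VV' (conn x y (C'C xC) (C'C yC))) ,
    (λ x y xC yV p → CC' (closed x y (C'C xC) (V'V yV) (path-monoV V'V p)))

  twoComponents-≐ : ∀ {A A' B B'} → ExactlyTwoComponents S A B → A ≐ A' → B ≐ B'
    → ExactlyTwoComponents S A' B'
  twoComponents-≐ (cA , cB , A≠B , only) eA eB =
    component-≐ cA eV eA , component-≐ cB eV eB ,
    (λ eAB → A≠B (≐-trans eA (≐-trans eAB (≐-sym eB)))) ,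
    λ C cC → Sum.map (λ e → ≐-trans e eA) (λ e → ≐-trans e eB) (only C (component-≐ cC (≐-sym eV) ≐-refl))
    where eV = ++-≐ eA eB

  twoComponents-swap : ∀ {A B} → ExactlyTwoComponents S A B → ExactlyTwoComponents S B A
  twoComponents-swap {A} {B} (cA , cB , A≠B , only) =
    component-≐ cB (++-comm-≐ {A}) ≐-refl , component-≐ cA (++-comm-≐ {A}) ≐-refl ,
    (λ e → A≠B (≐-sym e)) ,
    λ C cC → Sum.swap (only C (component-≐ cC (++-comm-≐ {B}) ≐-refl))

  onlyComponents : ∀ {A B} → IsComponent S (A ++ B) A → IsComponent S (A ++ B) B
    → ∀ C → IsComponent S (A ++ B) C → (C ≐ A) ⊎ (C ≐ B)
  onlyComponents {A} cA cB C cC@((x , xC) , C⊆ , _) with ∈-++⁻ A (C⊆ xC)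
  ... | inj₁ xA = inj₁ (component-share cC cA xC xA)
  ... | inj₂ xB = inj₂ (component-share cC cB xC xB)

  twoComponents-match : ∀ {A B A' B'} → ExactlyTwoComponents S A B → ExactlyTwoComponents S A' B'
    → (A' ++ B') ≐ (A ++ B) → (A' ≐ A × B' ≐ B) ⊎ (A' ≐ B × B' ≐ A)
  twoComponents-match (_ , _ , _ , only) (cA' , cB' , A'≠B' , _) same
    with only _ (component-≐ cA' same ≐-refl) | only _ (component-≐ cB' same ≐-refl)
  ... | inj₁ A'≐A | inj₂ B'≐B = inj₁ (A'≐A , B'≐B)
  ... | inj₂ A'≐B | inj₁ B'≐A = inj₂ (A'≐B , B'≐A)
  ... | inj₁ A'≐A | inj₁ B'≐A = ⊥-elim (A'≠B' (≐-trans A'≐A (≐-sym B'≐A)))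
  ... | inj₂ A'≐B | inj₂ B'≐B = ⊥-elim (A'≠B' (≐-trans A'≐B (≐-sym B'≐B)))

  inFrakL-swap : ∀ {r A B} → InFrakL r S A B → InFrakL r S B A
  inFrakL-swap {a , b , c} (A⊆ , B⊆ , two , sides) = B⊆ , A⊆ , twoComponents-swap two , Sum.swap sides

  frakLStar-swap : ∀ {r A B} → IsFrakLStar r S A B → IsFrakLStar r S B A
  frakLStar-swap {a , b , c} {A} {B} (frakL , maximal) =
    inFrakL-swap frakL ,
    λ A' B' frakL′ → ℕₚ.≤-trans (maximal A' B' frakL′) (cardUnion-mono {A} {B} {B} {A} (++-comm-⊆ {A}))

  inFrakL⇒joined : ∀ {a b c A B} → InFrakL (a , b , c) S A B
    → ∀ {w} → w ∈ A ++ B → Path S (A ++ B) a w ⊎ Path S (A ++ B) c w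
  inFrakL⇒joined {A = A} (_ , _ , (cA , cB , _) , sides) wm with sides | ∈-++⁻ A wm
  ... | inj₁ (aA , _ , cB') | inj₁ wA = inj₁ (component-path cA aA wA)
  ... | inj₁ (aA , _ , cB') | inj₂ wB = inj₂ (component-path cB cB' wB)
  ... | inj₂ (aB , _ , cA') | inj₁ wA = inj₂ (component-path cA cA' wA)
  ... | inj₂ (aB , _ , cA') | inj₂ wB = inj₁ (component-path cB aB wB)

twoComponents-enlarge : ∀ {S S' A B} → (∀ t → S t → S' t) → ExactlyTwoComponents S A B
  → (∀ {u w} → u ∈ A → w ∈ B → ¬ Edge S' (A ++ B) u w) → ExactlyTwoComponents S' A B
twoComponents-enlarge {S} {S'} {A} {B} S⊆S' (cA , cB , A≠B , _) noEdge =
  cA' , cB' , A≠B , onlyComponents cA' cB'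
  where
    enlarge : ∀ {C} → IsComponent S (A ++ B) C → (∀ {u w} → u ∈ C → Edge S' (A ++ B) u w → w ∈ C)
      → IsComponent S' (A ++ B) C
    enlarge (ne , C⊆ , conn , _) closed =
      ne , C⊆ , (λ x y xC yC → path-monoS S⊆S' (conn x y xC yC)) , λ x y xC _ p → closed⇒path∈ closed xC p
    cA' = enlarge cA λ uA e@(_ , _ , wV , _) → [ (λ wA → wA) , (λ wB → ⊥-elim (noEdge uA wB e)) ]′ (∈-++⁻ A wV)
    cB' = enlarge cB λ uB e@(_ , _ , wV , _) →
            [ (λ wA → ⊥-elim (noEdge wA uB (edge-sym {S'} e))) , (λ wB → wB) ]′ (∈-++⁻ A wV)

-- Decidable reachability in a finite graph: a walk from x either avoids
-- x afterwards or can be shortcut, so removing x bounds the search.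

module Reachability (E : ℕ → ℕ → Set) (E? : ∀ x y → Dec (E x y)) where

  Walk : List ℕ → ℕ → ℕ → Set
  Walk U = Star (λ u w → E u w × u ∈ U × w ∈ U)

  remove : ℕ → List ℕ → List ℕ
  remove x = filter (λ y → ¬? (y ℕ.≟ x))

  remove-⊆ : ∀ x U {y} → y ∈ remove x U → y ∈ U
  remove-⊆ x U m = proj₁ (∈-filter⁻ (λ y → ¬? (y ℕ.≟ x)) {xs = U} m)

  remove-∈ : ∀ x U {y} → y ∈ U → y ≢ x → y ∈ remove x U
  remove-∈ x U m ne = ∈-filter⁺ (λ y → ¬? (y ℕ.≟ x)) m ne

  remove-∉ : ∀ x U → x ∉ remove x U
  remove-∉ x U m = proj₂ (∈-filter⁻ (λ y → ¬? (y ℕ.≟ x)) {xs = U} m) refl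

  remove-shorter : ∀ {x U} → x ∈ U → length (remove x U) < length U
  remove-shorter {x} {U} m = Listₚ.filter-notAll (λ y → ¬? (y ℕ.≟ x)) U (Any.map (λ e ne → ne (sym e)) m)

  walk-mono : ∀ {U U' x y} → U ⊆ˡ U' → Walk U x y → Walk U' x y
  walk-mono U⊆ = Star.map λ (e , p , q) → e , U⊆ p , U⊆ q

  walk-outside : ∀ {U x y} → x ∉ U → Walk U x y → x ≡ y
  walk-outside x∉ ε       = refl
  walk-outside x∉ (e ◅ p) = ⊥-elim (x∉ (proj₁ (proj₂ e)))

  lastDeparture : ∀ {x s y} U → Walk U s y
    → Walk (remove x U) s y ⊎ (∃[ w ] (w ∈ remove x U × E x w × Walk (remove x U) w y)) ⊎ y ≡ x
  lastDeparture {x} {s} U ε with s ℕ.≟ x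
  ... | yes e = inj₂ (inj₂ e)
  ... | no _  = inj₁ ε
  lastDeparture {x} {s} U (_◅_ {j = w} (e , sU , wU) p) with lastDeparture {x} U p
  ... | inj₂ r = inj₂ r
  ... | inj₁ q with w ℕ.≟ x
  ... | yes refl = inj₂ (inj₂ (sym (walk-outside (remove-∉ x U) q)))
  ... | no w≢x with s ℕ.≟ x
  ... | yes refl = inj₂ (inj₁ (w , remove-∈ x U wU w≢x , e , q))
  ... | no s≢x   = inj₁ ((e , remove-∈ x U sU s≢x , remove-∈ x U wU w≢x) ◅ q)

  walk?-bounded : (n : ℕ) (U : List ℕ) → length U ≤ n → ∀ x y → Dec (Walk U x y)
  walk?-bounded n U le x y with x ℕ.≟ y
  ... | yes refl = yes ε
  ... | no x≢y with x ∈? U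
  ... | no x∉U = no λ p → x≢y (walk-outside x∉U p)
  walk?-bounded zero U le x y | no x≢y | yes x∈U =
    ⊥-elim (ℕₚ.<-irrefl refl (ℕₚ.<-≤-trans (remove-shorter x∈U) (ℕₚ.≤-trans le z≤n)))
  walk?-bounded (suc n) U le x y | no x≢y | yes x∈U
    with any? (λ w → E? x w ×-dec walk?-bounded n (remove x U) shorter w y) (remove x U)
    where shorter = ℕₚ.≤-pred (ℕₚ.≤-trans (remove-shorter x∈U) le)
  ... | yes found with find found
  ... | w , w∈ , e , p = yes ((e , x∈U , remove-⊆ x U w∈) ◅ walk-mono (remove-⊆ x U) p)
  walk?-bounded (suc n) U le x y | no x≢y | yes x∈U | no none = no λ p → impossible (lastDeparture {x} U p)
    where
      impossible : _ → ⊥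
      impossible (inj₁ q)                        = x≢y (walk-outside (remove-∉ x U) q)
      impossible (inj₂ (inj₁ (w , w∈ , e , q))) = none (lose w∈ (e , q))
      impossible (inj₂ (inj₂ e))                 = x≢y (sym e)

  walk? : ∀ U x y → Dec (Walk U x y)
  walk? U = walk?-bounded (length U) U ℕₚ.≤-refl

module Components (S : TripleSet) (path? : ∀ X x y → Dec (Path S X x y)) where

  componentOf : List ℕ → ℕ → List ℕ
  componentOf X x₀ = filter (path? X x₀) X

  componentOf-⊆ : ∀ X x₀ → componentOf X x₀ ⊆ˡ X
  componentOf-⊆ X x₀ m = proj₁ (∈-filter⁻ (path? X x₀) {xs = X} m)

  componentOf-∈ : ∀ {X x₀ y} → y ∈ X → Path S X x₀ y → y ∈ componentOf X x₀
  componentOf-∈ = ∈-filter⁺ (path? _ _)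

  componentOf-path : ∀ {X x₀ y} → y ∈ componentOf X x₀ → Path S X x₀ y
  componentOf-path {X} {x₀} m = proj₂ (∈-filter⁻ (path? X x₀) {xs = X} m)

  componentOf-isComponent : ∀ X x₀ → x₀ ∈ X → IsComponent S X (componentOf X x₀)
  componentOf-isComponent X x₀ x₀X =
    (x₀ , componentOf-∈ x₀X ε) , componentOf-⊆ X x₀ ,
    (λ x y xm ym → path-sym (componentOf-path xm) ◅◅ componentOf-path ym) ,
    (λ x y xm yX p → componentOf-∈ yX (componentOf-path xm ◅◅ p))

  twoComponents : ∀ {X a c} → a ∈ X → c ∈ X → ¬ Path S X a c
    → (∀ {y} → y ∈ X → Path S X a y ⊎ Path S X c y)
    → ExactlyTwoComponents S (componentOf X a) (componentOf X c)
      × (componentOf X a ++ componentOf X c) ≐ X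
  twoComponents {X} {a} {c} aX cX ¬ac joined =
    (compA , compC , (λ e → ¬ac (componentOf-path (proj₂ e (componentOf-∈ cX ε)))) , onlyComponents compA compC) ,
    union
    where
      union : (componentOf X a ++ componentOf X c) ≐ X
      union = ++-⊆ (componentOf-⊆ X a) (componentOf-⊆ X c) ,
              λ m → [ (λ p → ∈-++⁺ˡ (componentOf-∈ m p)) , (λ p → ∈-++⁺ʳ _ (componentOf-∈ m p)) ]′ (joined m)
      compA = component-≐ (componentOf-isComponent X a aX) (≐-sym union) ≐-refl
      compC = component-≐ (componentOf-isComponent X c cX) (≐-sym union) ≐-refl

-- Aho's algorithm,
-- run on L_R and guided by a triple ab|c ∈ cl(R), shrinks the current
-- leaf set X to the components of a and c.  Every discarded part can be
-- hung off as a separate subtree, so a triple of cl(R) never crosses a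
-- cut; in particular b stays with a, and so does every vertex joined to
-- a or c by triples of cl(R).

module Domination (R : List Triple) (T₀ : Tree) (unique₀ : Unique (leaves T₀))
                  (displays₀ : ∀ t → t ∈ᵀ R → Displays T₀ t) where

  ℛ : TripleSet
  ℛ = toSet R

  L : List ℕ
  L = leavesOf R

  L⊆T₀ : L ⊆ˡ leaves T₀
  L⊆T₀ m with leavesOf⇒LeafSet R m
  ... | t , t∈R , x∈t = displays⇒leaf (displays₀ t t∈R) x∈t

  ℛ-distinct : ∀ {x y z} → ℛ (x , y , z) → x ≢ y
  ℛ-distinct s = proj₁ (displays₀ _ s)

  ℛ-leaves : ∀ {x y z} → ℛ (x , y , z) → x ∈ L × y ∈ L × z ∈ L
  ℛ-leaves s = LeafSet⇒leavesOf R (_ , s , inj₁ refl) ,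
               LeafSet⇒leavesOf R (_ , s , inj₂ (inj₁ refl)) ,
               LeafSet⇒leavesOf R (_ , s , inj₂ (inj₂ refl))

  -- the trees quantified over in the definition of cl(R)
  Admissible : Tree → Set
  Admissible T = IsRootedTree T × (∀ x → (x ∈ leaves T) ⇔ LeafSet ℛ x) × (∀ s → s ∈ᵀ R → Displays T s)

  admissible-unique : ∀ {T} → Admissible T → Unique (leaves T)
  admissible-unique ((_ , _ , _ , _ , unique) , _) = unique

  cl⇒displays : ∀ {T r} → Admissible T → cl R r → Displays T r
  cl⇒displays (rooted , leafSet , displaysR) r∈cl = r∈cl _ rooted leafSet displaysR

  record Piece (P : List ℕ) (t : Tree) : Set where
    field
      nonRoot  : NonRootOK t
      unique   : Unique (leaves t)
      leaves≐  : leaves t ≐ P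
      displays : ∀ {x y z} → ℛ (x , y , z) → x ∈ P → y ∈ P → z ∈ P → Displays t (x , y , z)

  piece-≐ : ∀ {P Q t} → P ≐ Q → Piece P t → Piece Q t
  piece-≐ P≐Q p = record
    { nonRoot = nonRoot ; unique = unique ; leaves≐ = ≐-trans leaves≐ P≐Q
    ; displays = λ s x y z → displays s (Q⊆P x) (Q⊆P y) (Q⊆P z) }
    where
      open Piece p
      Q⊆P = proj₂ P≐Q

  piece : ∀ {P x} → P ⊆ˡ L → x ∈ P → ∃[ t ] Piece P t
  piece {P} P⊆L x∈P with restriction P T₀ unique₀ x∈P (L⊆T₀ (P⊆L x∈P))
  ... | t , r = t , record
    { nonRoot = nonRoot ; unique = unique
    ; leaves≐ = (λ m → proj₂ (leaves⊆ m)) , (λ m → leaves⊇ (L⊆T₀ (P⊆L m)) m)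
    ; displays = λ s x y z → displays x y z (displays₀ _ s) }
    where open Restriction r

  -- a context for X turns any piece on X into an admissible tree containing it
  Context : List ℕ → Set
  Context X = Σ (Tree → Tree) λ plug → ∀ t → Piece X t → Admissible (plug t) × t ⊑ plug t

  identityContext : ∀ {a b} → a ∈ L → b ∈ L → a ≢ b → Context L
  identityContext {a} {b} aL bL a≢b = (λ t → t) , λ t p → admissible t p , here
    where
      admissible : ∀ t → Piece L t → Admissible t
      admissible (leaf z) p with proj₂ (Piece.leaves≐ p) aL | proj₂ (Piece.leaves≐ p) bL
      ... | here refl | here refl = ⊥-elim (a≢b refl)
      admissible (node cs) record { nonRoot = nodeOK two all ; unique = unique ; leaves≐ = t⊆L , L⊆t ; displays = displays } =
        (cs , refl , (λ e → ℕₚ.<-irrefl (sym e) two) , all , unique) ,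
        (λ x → mk⇔ (λ m → leavesOf⇒LeafSet R (t⊆L m)) (λ l → L⊆t (LeafSet⇒leavesOf R l))) ,
        λ (x , y , z) s → let (xL , yL , zL) = ℛ-leaves s in displays s xL yL zL

  record Partition (X P₁ P₂ : List ℕ) : Set where
    field
      cover    : X ≐ (P₁ ++ P₂)
      disjoint : ∀ {x} → x ∈ P₁ → x ∈ P₂ → ⊥
      noCross  : ∀ {x y z} → ℛ (x , y , z) → x ∈ P₁ → y ∈ P₂ → z ∈ X → ⊥

  join : ∀ {X P₁ P₂ t₁ t₂} → Partition X P₁ P₂ → Piece P₁ t₁ → Piece P₂ t₂
    → Piece X (node (t₁ ∷ t₂ ∷ []))
  join {X} {P₁} {P₂} {t₁} {t₂} part p₁ p₂ = piece-≐ (≐-sym cover) record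
    { nonRoot  = nodeOK (s≤s (s≤s z≤n)) (Piece.nonRoot p₁ ∷ Piece.nonRoot p₂ ∷ [])
    ; unique   = Uniqueₚ.++⁺ (Piece.unique p₁) unique₂
                   λ (m₁ , m₂) → disjoint (t₁⊆ m₁) (t₂⊆ (subst (_ ∈_) (Listₚ.++-identityʳ (leaves t₂)) m₂))
    ; leaves≐  = t⊆ , ⊆t
    ; displays = displays }
    where
      open Partition part
      t₁⊆ = proj₁ (Piece.leaves≐ p₁) ; ⊆t₁ = proj₂ (Piece.leaves≐ p₁)
      t₂⊆ = proj₁ (Piece.leaves≐ p₂) ; ⊆t₂ = proj₂ (Piece.leaves≐ p₂)
      unique₂ : Unique (leaves t₂ ++ [])
      unique₂ = subst Unique (sym (Listₚ.++-identityʳ (leaves t₂))) (Piece.unique p₂)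
      t⊆ : leavesL (t₁ ∷ t₂ ∷ []) ⊆ˡ (P₁ ++ P₂)
      t⊆ m with childContaining (t₁ ∷ t₂ ∷ []) m
      ... | _ , here refl , q         = ∈-++⁺ˡ (t₁⊆ q)
      ... | _ , there (here refl) , q = ∈-++⁺ʳ P₁ (t₂⊆ q)
      inX : ∀ {x} → x ∈ P₁ ++ P₂ → x ∈ X
      inX = proj₂ cover
      ⊆t : (P₁ ++ P₂) ⊆ˡ leavesL (t₁ ∷ t₂ ∷ [])
      ⊆t = ++-⊆ (λ m → leaves-child {cs = t₁ ∷ t₂ ∷ []} (here refl) (⊆t₁ m))
                 (λ m → leaves-child {cs = t₁ ∷ t₂ ∷ []} (there (here refl)) (⊆t₂ m))
      -- triples inside one part are displayed by that subtree, triples with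
      -- xy in one part and z in the other are separated at the new root,
      -- and no triple has x and y in different parts
      displays : ∀ {x y z} → ℛ (x , y , z) → x ∈ P₁ ++ P₂ → y ∈ P₁ ++ P₂ → z ∈ P₁ ++ P₂
        → Displays (node (t₁ ∷ t₂ ∷ [])) (x , y , z)
      displays {x} {y} {z} s xm ym zm with displays₀ _ s | ∈-++⁻ P₁ xm | ∈-++⁻ P₁ ym | ∈-++⁻ P₁ zm
      ... | _ | inj₁ x₁ | inj₁ y₁ | inj₁ z₁ = displays-child (here refl) (Piece.displays p₁ s x₁ y₁ z₁)
      ... | _ | inj₂ x₂ | inj₂ y₂ | inj₂ z₂ = displays-child (there (here refl)) (Piece.displays p₂ s x₂ y₂ z₂)
      ... | (n₁ , n₂ , n₃ , _) | inj₁ x₁ | inj₁ y₁ | inj₂ z₂ =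
        n₁ , n₂ , n₃ , ⊆t xm , ⊆t ym , ⊆t zm , t₁ , child (here refl) here , ⊆t₁ x₁ , ⊆t₁ y₁ ,
        λ m → disjoint (t₁⊆ m) z₂
      ... | (n₁ , n₂ , n₃ , _) | inj₂ x₂ | inj₂ y₂ | inj₁ z₁ =
        n₁ , n₂ , n₃ , ⊆t xm , ⊆t ym , ⊆t zm , t₂ , child (there (here refl)) here , ⊆t₂ x₂ , ⊆t₂ y₂ ,
        λ m → disjoint z₁ (t₂⊆ m)
      ... | _ | inj₁ x₁ | inj₂ y₂ | _ = ⊥-elim (noCross s x₁ y₂ (inX zm))
      ... | _ | inj₂ x₂ | inj₁ y₁ | _ = ⊥-elim (noCross (∈ᵀ-swap s) y₁ x₂ (inX zm))

  cl-swap : ∀ {x y z} → cl R (x , y , z) → cl R (y , x , z)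
  cl-swap r∈cl T rooted leafSet displaysR = displays-swap (r∈cl T rooted leafSet displaysR)

  part₁⊆ : ∀ {X P₁ P₂} → Partition X P₁ P₂ → P₁ ⊆ˡ X
  part₁⊆ part m = proj₂ (Partition.cover part) (∈-++⁺ˡ m)

  part₂⊆ : ∀ {X P₁ P₂} → Partition X P₁ P₂ → P₂ ⊆ˡ X
  part₂⊆ {P₁ = P₁} part m = proj₂ (Partition.cover part) (∈-++⁺ʳ P₁ m)

  -- No triple xy|z of cl(R) has x, y on different sides of a partition of
  -- X and z ∈ X: hanging pieces on the two sides below a new vertex and
  -- plugging it into the context gives an admissible tree separating x, y.
  cl-noCross : ∀ {X P₁ P₂ x y z} → Context X → X ⊆ˡ L → Partition X P₁ P₂
    → cl R (x , y , z) → x ∈ P₁ → y ∈ P₂ → z ∈ X → ⊥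
  cl-noCross {X} {P₁} {P₂} {x} {y} (plug , plugged) X⊆L part r∈cl x₁ y₂ zX
    with piece (X⊆L ∘′ part₁⊆ part) x₁ | piece (X⊆L ∘′ part₂⊆ part) y₂
  ... | t₁ , p₁ | t₂ , p₂ =
    separated⇒¬displays (admissible-unique (proj₁ admissible)) (proj₂ admissible) separated
      (⊆t (part₁⊆ part x₁)) (⊆t zX)
      (cl⇒displays (proj₁ admissible) r∈cl)
    where
      joined = join part p₁ p₂
      admissible = plugged _ joined
      ⊆t = proj₂ (Piece.leaves≐ joined)
      separated : ¬ Same (t₁ ∷ t₂ ∷ []) x y
      separated (_ , here refl , _ , yt₁)         = Partition.disjoint part (proj₁ (Piece.leaves≐ p₁) yt₁) y₂
      separated (_ , there (here refl) , xt₂ , _) = Partition.disjoint part x₁ (proj₁ (Piece.leaves≐ p₂) xt₂)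

  -- after cutting off P₂, a piece on P₁ is plugged in next to a fixed piece on P₂
  context-restrict : ∀ {X P₁ P₂ y} → Context X → X ⊆ˡ L → Partition X P₁ P₂ → y ∈ P₂ → Context P₁
  context-restrict (plug , plugged) X⊆L part y₂ with piece (X⊆L ∘′ part₂⊆ part) y₂
  ... | t₂ , p₂ =
    (λ t → plug (node (t ∷ t₂ ∷ []))) ,
    λ t p → let (admissible , ⊑plug) = plugged _ (join part p p₂)
            in admissible , ⊑-trans (child (here refl) here) ⊑plug

  cl-path-stays : ∀ {X P₁ P₂ V} → Context X → X ⊆ˡ L → Partition X P₁ P₂ → V ⊆ˡ X
    → ∀ {u w} → u ∈ P₁ → Path (cl R) V u w → w ∈ P₁
  cl-path-stays {X} {P₁} cx X⊆L part V⊆X = closed⇒path∈ step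
    where
      step : ∀ {u w} → u ∈ P₁ → Edge (cl R) _ u w → w ∈ P₁
      step u₁ (_ , _ , wV , z , zV , uwz) with ∈-++⁻ P₁ (proj₁ (Partition.cover part) (V⊆X wV))
      ... | inj₁ w₁ = w₁
      ... | inj₂ w₂ = ⊥-elim (cl-noCross cx X⊆L part ([ (λ r → r) , cl-swap ]′ uwz) u₁ w₂ (V⊆X zV))

  module PartitionBy (X : List ℕ) {Q : ℕ → Set} (Q? : ∀ x → Dec (Q x))
                     (closed : ∀ {x y z} → ℛ (x , y , z) → x ∈ X → y ∈ X → z ∈ X → Q x → Q y) where

    ¬Q? : ∀ x → Dec (¬ Q x)
    ¬Q? x = ¬? (Q? x)

    P₁ P₂ : List ℕ
    P₁ = filter Q? X
    P₂ = filter ¬Q? X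

    in₁ : ∀ {x} → x ∈ X → Q x → x ∈ P₁
    in₁ = ∈-filter⁺ Q?

    in₂ : ∀ {x} → x ∈ X → ¬ Q x → x ∈ P₂
    in₂ = ∈-filter⁺ ¬Q?

    out₁ : ∀ {x} → x ∈ P₁ → x ∈ X × Q x
    out₁ = ∈-filter⁻ Q? {xs = X}

    out₂ : ∀ {x} → x ∈ P₂ → x ∈ X × ¬ Q x
    out₂ = ∈-filter⁻ ¬Q? {xs = X}

    partition : Partition X P₁ P₂
    partition = record
      { cover    = split , ++-⊆ (proj₁ ∘′ out₁) (proj₁ ∘′ out₂)
      ; disjoint = λ m₁ m₂ → proj₂ (out₂ m₂) (proj₂ (out₁ m₁))
      ; noCross  = λ s x₁ y₂ zX →
          proj₂ (out₂ y₂) (closed s (proj₁ (out₁ x₁)) (proj₁ (out₂ y₂)) zX (proj₂ (out₁ x₁)))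
      }
      where
        split : X ⊆ˡ (P₁ ++ P₂)
        split {x} m with Q? x
        ... | yes q = ∈-++⁺ˡ (in₁ m q)
        ... | no ¬q = ∈-++⁺ʳ P₁ (in₂ m ¬q)

    shorter : ∀ {x} → x ∈ X → ¬ Q x → length P₁ < length X
    shorter m ¬q = Listₚ.filter-notAll Q? X (Any.map (λ { refl → ¬q }) m)

  path? : ∀ X x y → Dec (Path ℛ X x y)
  path? X x y with Reachability.walk? (Edge ℛ X) edge? X x y
    where
      edge? : ∀ x y → Dec (Edge ℛ X x y)
      edge? x y = ¬? (x ℕ.≟ y) ×-dec (x ∈? X) ×-dec (y ∈? X) ×-dec third
        where
          third : Dec (∃[ z ] (z ∈ X × (ℛ (x , y , z) ⊎ ℛ (y , x , z))))
          third with any? (λ z → ((x , y , z) ∈ᵀ? R) ⊎-dec ((y , x , z) ∈ᵀ? R)) X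
          ... | yes found = yes (find found)
          ... | no none   = no λ (z , m , q) → none (lose m q)
  ... | yes p = yes (Star.map proj₁ p)
  ... | no ¬p = no λ p → ¬p (Star.map (λ e@(_ , xX , yX , _) → e , xX , yX) p)

  open Components ℛ path?

  Dominated : Triple → List ℕ → Set
  Dominated r V = Σ (List ℕ) λ A → Σ (List ℕ) λ B → InFrakL r ℛ A B × V ⊆ˡ (A ++ B)

  module _ {a b c : ℕ} (r∈cl : cl R (a , b , c)) (a≢b : a ≢ b) (V : List ℕ)
           (joinedV : ∀ {w} → w ∈ V → Path (cl R) V a w ⊎ Path (cl R) V c w) where

    extend : ∀ {X u x y z} → ℛ (x , y , z) → x ∈ X → y ∈ X → z ∈ X → Path ℛ X u x → Path ℛ X u y
    extend s xX yX zX p = p ◅◅ ((ℛ-distinct s , xX , yX , _ , zX , inj₁ s) ◅ ε)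

    joinedAC? : ∀ X y → Dec (Path ℛ X a y ⊎ Path ℛ X c y)
    joinedAC? X y = path? X a y ⊎-dec path? X c y

    module ByA (X : List ℕ) = PartitionBy X (path? X a) extend
    module ByAC (X : List ℕ) =
      PartitionBy X (joinedAC? X) (λ s xX yX zX → Sum.map (extend s xX yX zX) (extend s xX yX zX))

    -- When every vertex of X is joined to a or c, the components of a and c
    -- are the required pair: a and c are not joined, since otherwise the
    -- Ahograph [R, X] would be connected, which the tree T₀ forbids.
    finish : ∀ {X} → X ⊆ˡ L → a ∈ X → b ∈ X → c ∈ X → V ⊆ˡ X → Path ℛ X a b
      → (∀ {y} → y ∈ X → Path ℛ X a y ⊎ Path ℛ X c y) → Dominated (a , b , c) V
    finish {X} X⊆L aX bX cX V⊆X ab joined with path? X a c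
    ... | yes ac = ⊥-elim (AhoSeparation.disconnected unique₀ displays₀ X (L⊆T₀ ∘′ X⊆L) aX bX a≢b
                             λ u w → path-sym (fromA u) ◅◅ fromA w)
      where
        fromA : ∀ {y} → y ∈ X → Path ℛ X a y
        fromA m = [ (λ p → p) , (λ p → ac ◅◅ p) ]′ (joined m)
    ... | no ¬ac =
      componentOf X a , componentOf X c ,
      (inL (componentOf-⊆ X a) , inL (componentOf-⊆ X c) , proj₁ two ,
       inj₁ (componentOf-∈ aX ε , componentOf-∈ bX ab , componentOf-∈ cX ε)) ,
      proj₂ (proj₂ two) ∘′ V⊆X
      where
        two = twoComponents aX cX ¬ac joined
        inL : ∀ {P} → P ⊆ˡ X → ∀ {x} → x ∈ P → LeafSet ℛ x
        inL P⊆X m = leavesOf⇒LeafSet R (X⊆L (P⊆X m))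

    -- Invariant: X ⊆ L_R has a context and contains a, b, c and V.  If b
    -- is not joined to a, cutting off a's component contradicts ab|c ∈ cl(R);
    -- if some vertex is joined to neither a nor c, cut it off and recurse.
    aho : (n : ℕ) (X : List ℕ) → length X ≤ n → Context X → X ⊆ˡ L
      → a ∈ X → b ∈ X → c ∈ X → V ⊆ˡ X → Dominated (a , b , c) V
    aho zero [] _ _ _ () _ _ _
    aho zero (_ ∷ _) () _ _ _ _ _ _
    aho (suc n) X le cx X⊆L aX bX cX V⊆X with path? X a b
    ... | no ¬ab = ⊥-elim (cl-noCross cx X⊆L partition r∈cl (in₁ aX ε) (in₂ bX ¬ab) cX)
      where open ByA X
    ... | yes ab with all? (joinedAC? X) X
    ...   | yes all = finish X⊆L aX bX cX V⊆X ab (All.lookup all)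
    ...   | no ¬all with counterexample (joinedAC? X) X ¬all
    ...     | x , xX , ¬joined =
      aho n P₁ (ℕₚ.≤-pred (ℕₚ.<-≤-trans (shorter xX ¬joined) le))
          (context-restrict cx X⊆L partition (in₂ xX ¬joined))
          (X⊆L ∘′ part₁⊆ partition) a₁ (in₁ bX (inj₁ ab)) c₁
          (λ m → [ cl-path-stays cx X⊆L partition V⊆X a₁ , cl-path-stays cx X⊆L partition V⊆X c₁ ]′ (joinedV m))
      where
        open ByAC X
        a₁ = in₁ aX (inj₁ ε)
        c₁ = in₁ cX (inj₂ ε)

    dominate : a ∈ L → b ∈ L → c ∈ L → V ⊆ˡ L → Dominated (a , b , c) V
    dominate aL bL cL V⊆L = aho (length L) L ℕₚ.≤-refl (identityContext aL bL a≢b) (λ m → m) aL bL cL V⊆L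

module Closure (R : List Triple) (T₀ : Tree) (unique₀ : Unique (leaves T₀))
               (displays₀ : ∀ t → t ∈ᵀ R → Displays T₀ t) {s₀ : Triple} (s₀∈R : s₀ ∈ᵀ R) where

  open Domination R T₀ unique₀ displays₀

  -- Tₛ, the restriction of T₀ to L_R, is admissible (R is nonempty, so L_R
  -- has two distinct leaves); hence it displays every triple of cl(R).
  private
    s₀-leaves = ℛ-leaves s₀∈R
    pieceₛ = piece (λ m → m) (proj₁ s₀-leaves)

  Tₛ : Tree
  Tₛ = proj₁ pieceₛ

  admissibleₛ : Admissible Tₛ
  admissibleₛ = proj₁ (proj₂ (identityContext (proj₁ s₀-leaves) (proj₁ (proj₂ s₀-leaves)) (ℛ-distinct s₀∈R))
                             Tₛ (proj₂ pieceₛ))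

  uniqueₛ : Unique (leaves Tₛ)
  uniqueₛ = admissible-unique admissibleₛ

  ℛ⊆cl : ∀ t → ℛ t → cl R t
  ℛ⊆cl t t∈R T rooted leafSet displaysR = displaysR t t∈R

  cl⇒displaysₛ : ∀ t → cl R t → Displays Tₛ t
  cl⇒displaysₛ t = cl⇒displays admissibleₛ

  Tₛ⊆L : leaves Tₛ ⊆ˡ L
  Tₛ⊆L {x} m = LeafSet⇒leavesOf R (Equivalence.to (proj₁ (proj₂ admissibleₛ) x) m)

  L⊆Tₛ : L ⊆ˡ leaves Tₛ
  L⊆Tₛ {x} m = Equivalence.from (proj₁ (proj₂ admissibleₛ) x) (leavesOf⇒LeafSet R m)

  ℛ-leafSet⇒L : ∀ {x} → LeafSet ℛ x → x ∈ L
  ℛ-leafSet⇒L = LeafSet⇒leavesOf R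

  cl-leafSet⇒L : ∀ {x} → LeafSet (cl R) x → x ∈ L
  cl-leafSet⇒L (t , r∈cl , x∈t) = Tₛ⊆L (displays⇒leaf (cl⇒displaysₛ t r∈cl) x∈t)

  cl-distinct : ∀ {a b c} → cl R (a , b , c) → a ≢ b
  cl-distinct r∈cl = proj₁ (cl⇒displaysₛ _ r∈cl)

  cl-leaves : ∀ {a b c} → cl R (a , b , c) → a ∈ L × b ∈ L × c ∈ L
  cl-leaves r∈cl = cl-leafSet⇒L (_ , r∈cl , inj₁ refl) , cl-leafSet⇒L (_ , r∈cl , inj₂ (inj₁ refl)) ,
                   cl-leafSet⇒L (_ , r∈cl , inj₂ (inj₂ refl))

  frakL-⊆L : ∀ {S r A B} → (∀ {x} → LeafSet S x → x ∈ L) → InFrakL r S A B → (A ++ B) ⊆ˡ L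
  frakL-⊆L {r = a , b , c} ⊆L (A⊆ , B⊆ , _) = ++-⊆ (⊆L ∘′ A⊆) (⊆L ∘′ B⊆)

  dominate-cl : ∀ {a b c} → cl R (a , b , c) → ∀ V → V ⊆ˡ L
    → (∀ {w} → w ∈ V → Path (cl R) V a w ⊎ Path (cl R) V c w) → Dominated (a , b , c) V
  dominate-cl r∈cl V V⊆L joined with cl-leaves r∈cl
  ... | aL , bL , cL = dominate r∈cl (cl-distinct r∈cl) V joined aL bL cL V⊆L

  -- 𝔏(r; R) ⊆ 𝔏(r; cl(R)): a triple uw|z of cl(R) joining the two components
  -- A, B of [R, A ∪ B] is impossible, since at the lowest common ancestor
  -- of u and w in Tₛ the connected sets A and B, and the edge uw, would all
  -- lie below a single child.
  module _ {A B : List ℕ} (two : ExactlyTwoComponents ℛ A B) (A⊆L : A ⊆ˡ L) (B⊆L : B ⊆ˡ L) where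

    private
      W = A ++ B
      module ℛ-Sep  = AhoSeparation {ℛ} uniqueₛ (λ t → cl⇒displaysₛ t ∘′ ℛ⊆cl t)
      module cl-Sep = AhoSeparation {cl R} uniqueₛ cl⇒displaysₛ

    noEdge-cl : ∀ {u w} → u ∈ A → w ∈ B → ¬ Edge (cl R) W u w
    noEdge-cl {u} {w} uA wB e@(u≢w , uW , wW , _)
      with splitVertex W uW wW u≢w Tₛ uniqueₛ (λ m → L⊆Tₛ (++-⊆ A⊆L B⊆L m))
    ... | cs , v⊑Tₛ , W⊆cs , x , y , xW , yW , ¬same =
      ¬same (same-trans {cs} uniqueCs (same-sym {cs} (fromU xW)) (fromU yW))
      where
        uniqueCs = unique-⊑ uniqueₛ v⊑Tₛ
        fromU : ∀ {v} → v ∈ W → Same cs u v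
        fromU vW with ∈-++⁻ A vW
        ... | inj₁ vA = ℛ-Sep.path-same v⊑Tₛ W⊆cs (component-path (proj₁ two) uA vA) uW
        ... | inj₂ vB = same-trans {cs} uniqueCs (cl-Sep.edge-same v⊑Tₛ W⊆cs e)
                          (ℛ-Sep.path-same v⊑Tₛ W⊆cs (component-path (proj₁ (proj₂ two)) wB vB) wW)

    twoComponents-cl : ExactlyTwoComponents (cl R) A B
    twoComponents-cl = twoComponents-enlarge ℛ⊆cl two noEdge-cl

  inFrakL-cl : ∀ {r A B} → InFrakL r ℛ A B → InFrakL r (cl R) A B
  inFrakL-cl {a , b , c} (A⊆ , B⊆ , two , sides) =
    toCl ∘′ A⊆ , toCl ∘′ B⊆ , twoComponents-cl two (ℛ-leafSet⇒L ∘′ A⊆) (ℛ-leafSet⇒L ∘′ B⊆) , sides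
    where
      toCl : ∀ {x} → LeafSet ℛ x → LeafSet (cl R) x
      toCl (t , t∈R , x∈t) = t , ℛ⊆cl t t∈R , x∈t

  dominate-frakL : ∀ {r A B} → cl R r → InFrakL r (cl R) A B → Dominated r (A ++ B)
  dominate-frakL {a , b , c} r∈cl frakL =
    dominate-cl r∈cl _ (frakL-⊆L cl-leafSet⇒L frakL) (inFrakL⇒joined frakL)

  frakLStar-ℛ⇒cl : ∀ {r A B} → cl R r → IsFrakLStar r ℛ A B → IsFrakLStar r (cl R) A B
  frakLStar-ℛ⇒cl {a , b , c} {A} {B} r∈cl (frakL , maximal) = inFrakL-cl frakL , maximal′
    where
      maximal′ : ∀ A' B' → InFrakL (a , b , c) (cl R) A' B' → cardUnion A' B' ≤ cardUnion A B
      maximal′ A' B' frakL′ with dominate-frakL r∈cl frakL′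
      ... | A″ , B″ , frakL″ , ⊆″ =
        ℕₚ.≤-trans (cardUnion-mono {A'} {B'} {A″} {B″} ⊆″) (maximal A″ B″ frakL″)

  -- The dominating member {A″, B″} of 𝔏(r; R) is at most as large, hence has
  -- the same union; its parts are then components of [cl(R), A ∪ B], so
  -- they are A and B again, which are therefore the components of [R, A ∪ B].
  frakLStar-cl⇒ℛ : ∀ {r A B} → cl R r → IsFrakLStar r (cl R) A B → IsFrakLStar r ℛ A B
  frakLStar-cl⇒ℛ {a , b , c} {A} {B} r∈cl (frakL , maximal) = fromDominating (dominate-frakL r∈cl frakL)
    where
      toℛ : ∀ {x} → LeafSet (cl R) x → LeafSet ℛ x
      toℛ = leavesOf⇒LeafSet R ∘′ cl-leafSet⇒L

      fromDominating : Dominated (a , b , c) (A ++ B) → IsFrakLStar (a , b , c) ℛ A B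
      fromDominating (A″ , B″ , frakL″ , ⊆″) =
        (toℛ ∘′ A⊆ , toℛ ∘′ B⊆ , twoℛ , sides) , λ A' B' frakL′ → maximal A' B' (inFrakL-cl frakL′)
        where
          A⊆ = proj₁ frakL
          B⊆ = proj₁ (proj₂ frakL)
          two = proj₁ (proj₂ (proj₂ frakL))
          sides = proj₂ (proj₂ (proj₂ frakL))
          same : (A ++ B) ≐ (A″ ++ B″)
          same = cardUnion-≐ {A} {B} {A″} {B″} ⊆″ (maximal A″ B″ (inFrakL-cl frakL″))
          two″ = proj₁ (proj₂ (proj₂ frakL″))
          twoℛ : ExactlyTwoComponents ℛ A B
          twoℛ = [ (λ (A″≐A , B″≐B) → twoComponents-≐ two″ A″≐A B″≐B)
                 , (λ (A″≐B , B″≐A) → twoComponents-swap (twoComponents-≐ two″ A″≐B B″≐A)) ]′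
                 (twoComponents-match two (proj₁ (proj₂ (proj₂ (inFrakL-cl frakL″)))) (≐-sym same))

  Separates : List ℕ → List ℕ → Triple → Set
  Separates P Q (p , q , z) = p ∈ P × q ∈ P × z ∈ Q

  -- If A is a component of [R, A ∪ B] with two distinct vertices, some triple
  -- of R lies in A ∪ B with its pair in A: otherwise [R, A] itself would be
  -- connected, which T₀ forbids.
  separatingTriple : ∀ {A B a b} → ExactlyTwoComponents ℛ A B → A ⊆ˡ L → a ∈ A → b ∈ A → a ≢ b
    → ∃[ r ] (ℛ r × Separates A B r)
  separatingTriple {A} {B} two A⊆L aA bA a≢b with any? (λ (p , q , z) → (p ∈? A) ×-dec (q ∈? A) ×-dec (z ∈? B)) R
  ... | yes found = let (r , r∈R , sep) = find found in r , Any.map inj₁ r∈R , sep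
  ... | no none = ⊥-elim (AhoSeparation.disconnected unique₀ displays₀ A (L⊆T₀ ∘′ A⊆L) aA bA a≢b
                            λ uA wA → inside uA (component-path (proj₁ two) uA wA))
    where
      unseparated : ∀ {u w z} → ℛ (u , w , z) → u ∈ A → w ∈ A → z ∈ B → ⊥
      unseparated t uA wA zB with find t
      ... | _ , r∈R , inj₁ refl = none (lose r∈R (uA , wA , zB))
      ... | _ , r∈R , inj₂ refl = none (lose r∈R (wA , uA , zB))
      inside : ∀ {u w} → u ∈ A → Path ℛ (A ++ B) u w → Path ℛ A u w
      inside uA ε = ε
      inside uA (e@(u≢w , _ , wV , z , zV , uwz) ◅ p) with component-closed (proj₁ two) uA wV (e ◅ ε) | ∈-++⁻ A zV
      ... | wA | inj₁ zA = (u≢w , uA , wA , z , zA , uwz) ◅ inside wA p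
      ... | wA | inj₂ zB = ⊥-elim ([ (λ t → unseparated t uA wA zB) , (λ t → unseparated t wA uA zB) ]′ uwz)

  -- Replacing ab|c by a separating triple r' of R keeps {P, Q} in 𝔏(r'; R)
  -- and keeps it maximal: a member {A', B'} of 𝔏(r'; R) together with P ∪ Q
  -- is joined to a or c, hence dominated by a member of 𝔏(ab|c; R).
  frakLStar-separating : ∀ {a b c P Q p q z} → cl R (a , b , c) → IsFrakLStar (a , b , c) ℛ P Q
    → a ∈ P → c ∈ Q → Separates P Q (p , q , z) → IsFrakLStar (p , q , z) ℛ P Q
  frakLStar-separating {a} {b} {c} {P} {Q} {p} {q} {z} r∈cl (frakL , maximal) aP cQ (pP , qP , zQ) =
    (P⊆ , Q⊆ , two , inj₁ (pP , qP , zQ)) , maximal′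
    where
      P⊆ = proj₁ frakL
      Q⊆ = proj₁ (proj₂ frakL)
      two = proj₁ (proj₂ (proj₂ frakL))
      a→p = component-path (proj₁ two) aP pP
      c→z = component-path (proj₁ (proj₂ two)) cQ zQ
      maximal′ : ∀ A' B' → InFrakL (p , q , z) ℛ A' B' → cardUnion A' B' ≤ cardUnion P Q
      maximal′ A' B' frakL′ = bound (dominate-cl r∈cl V V⊆L joined)
        where
          V = (P ++ Q) ++ (A' ++ B')
          V⊆L = ++-⊆ (frakL-⊆L ℛ-leafSet⇒L frakL) (frakL-⊆L ℛ-leafSet⇒L frakL′)
          lift : ∀ {U x y} → U ⊆ˡ V → Path ℛ U x y → Path (cl R) V x y
          lift U⊆V = path-monoS ℛ⊆cl ∘′ path-monoV U⊆V
          joined : ∀ {w} → w ∈ V → Path (cl R) V a w ⊎ Path (cl R) V c w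
          joined wV = [ (λ w∈PQ → Sum.map (lift ∈-++⁺ˡ) (lift ∈-++⁺ˡ) (inFrakL⇒joined frakL w∈PQ))
                      , (λ w∈A'B' → Sum.map (λ p→w → lift ∈-++⁺ˡ a→p ◅◅ lift (∈-++⁺ʳ (P ++ Q)) p→w)
                                            (λ z→w → lift ∈-++⁺ˡ c→z ◅◅ lift (∈-++⁺ʳ (P ++ Q)) z→w)
                                            (inFrakL⇒joined frakL′ w∈A'B')) ]′ (∈-++⁻ (P ++ Q) wV)
          bound : Dominated (a , b , c) V → cardUnion A' B' ≤ cardUnion P Q
          bound (A″ , B″ , frakL″ , ⊆″) =
            ℕₚ.≤-trans (cardUnion-mono {A'} {B'} {A″} {B″} (⊆″ ∘′ ∈-++⁺ʳ (P ++ Q))) (maximal A″ B″ frakL″)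

  frakLStar-oriented : ∀ {a b c P Q} → cl R (a , b , c) → IsFrakLStar (a , b , c) ℛ P Q
    → a ∈ P → b ∈ P → c ∈ Q → ∃[ r' ] (ℛ r' × IsFrakLStar r' ℛ P Q)
  frakLStar-oriented r∈cl star aP bP cQ =
    let (r' , r'∈R , sep) = separatingTriple (proj₁ (proj₂ (proj₂ (proj₁ star))))
                              (ℛ-leafSet⇒L ∘′ proj₁ (proj₁ star)) aP bP (cl-distinct r∈cl)
    in r' , r'∈R , frakLStar-separating r∈cl star aP cQ sep

  frakLStar-realized : ∀ {r A B} → cl R r → IsFrakLStar r ℛ A B → ∃[ r' ] (ℛ r' × IsFrakLStar r' ℛ A B)
  frakLStar-realized {a , b , c} {A} {B} r∈cl star = [ inA , inB ]′ (proj₂ (proj₂ (proj₂ (proj₁ star))))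
    where
      inA : a ∈ A × b ∈ A × c ∈ B → ∃[ r' ] (ℛ r' × IsFrakLStar r' ℛ A B)
      inA (aA , bA , cB) = frakLStar-oriented r∈cl star aA bA cB
      inB : a ∈ B × b ∈ B × c ∈ A → ∃[ r' ] (ℛ r' × IsFrakLStar r' ℛ A B)
      inB (aB , bB , cA) = let (r' , r'∈R , star′) = frakLStar-oriented r∈cl (frakLStar-swap star) aB bB cA
                           in r' , r'∈R , frakLStar-swap star′

  closureTheorem : ∀ A B → (InFrakLStarSet ℛ ℛ A B ⇔ InFrakLStarSet (cl R) ℛ A B)
                         × (InFrakLStarSet (cl R) ℛ A B ⇔ InFrakLStarSet (cl R) (cl R) A B)
  closureTheorem A B =
    mk⇔ (λ (r , r∈R , star) → r , ℛ⊆cl r r∈R , star)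
        (λ (r , r∈cl , star) → frakLStar-realized r∈cl star) ,
    mk⇔ (λ (r , r∈cl , star) → r , r∈cl , frakLStar-ℛ⇒cl r∈cl star)
        (λ (r , r∈cl , star) → r , r∈cl , frakLStar-cl⇒ℛ r∈cl star)

-- The theorem.  For R = ∅ all three sets are empty.

-- cl(∅) is empty: the tree consisting of a bare root displays no triple
cl-empty : ∀ {r} → ¬ cl [] r
cl-empty {a , b , c} r∈cl
  with r∈cl (node []) ([] , refl , (λ ()) , [] , []) (λ x → mk⇔ (λ ()) λ { (_ , () , _) }) (λ _ ())
... | _ , _ , _ , () , _

mainTheorem8 : (R : List Triple) → Consistent R → (A B : List ℕ)
    → (InFrakLStarSet (toSet R) (toSet R) A B ⇔ InFrakLStarSet (cl R) (toSet R) A B)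
      × (InFrakLStarSet (cl R) (toSet R) A B ⇔ InFrakLStarSet (cl R) (cl R) A B)
mainTheorem8 [] _ A B =
  mk⇔ (λ { (_ , () , _) }) (λ (_ , r∈cl , _) → ⊥-elim (cl-empty r∈cl)) ,
  mk⇔ (λ (_ , r∈cl , _) → ⊥-elim (cl-empty r∈cl)) (λ (_ , r∈cl , _) → ⊥-elim (cl-empty r∈cl))
mainTheorem8 R@(_ ∷ _) (T₀ , (_ , _ , _ , _ , unique₀) , displays₀) A B =
  Closure.closureTheorem R T₀ unique₀ displays₀ (here (inj₁ refl)) A B
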